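{- Let $G=(V_1\,\dot\cup\,V_2,E)$ be a graph such that $G[V_1]\not\rightarrow(K_3)$, $G[V_2]\not\rightarrow(K_4)^v$, and $G[V_2]$ does not contain any subgraph $H$ with $\rho(H)\geq 2$ and $|V(H)|\leq 8$. Then $G\not\rightarrow(K_4,K_4)$.
   Context: $G[U]$ denotes the subgraph induced by $U$. $G\not\rightarrow(K_3)$ means there is a 2-colouring of the edges of $G$ with no monochromatic triangle. $G\not\rightarrow(K_4)^v$ means there is a 2-colouring of the vertices of $G$ with no monochromatic copy of $K_4$ (a copy of $K_4$ all of whose vertices have the same colour). $\rho(H)=|E(H)|/|V(H)|$. $G\not\rightarrow(K_4,K_4)$ means there is a 2-colouring of the edges of $G$ with no monochromatic copy of $K_4$. -}

module Defs where

open import Data.Nat using (ℕ; zero; suc; _+_; _*_; _≤_)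
open import Data.Bool using (Bool; true; false; if_then_else_; _∧_)
open import Data.Fin using (Fin; zero; suc; _<_)
open import Data.Fin.Properties using (_<?_)
open import Data.Product using (_×_; Σ; ∃)
open import Relation.Nullary using (¬_)
open import Relation.Nullary.Decidable using (⌊_⌋)
open import Relation.Binary.PropositionalEquality using (_≡_)

record Graph (n : ℕ) : Set where
  field
    adj    : Fin n → Fin n → Bool
    sym    : ∀ i j → adj i j ≡ adj j i
    irrefl : ∀ i → adj i i ≡ false
open Graph public

∑ : ∀ {n} → (Fin n → ℕ) → ℕ
∑ {zero}  f = 0
∑ {suc n} f = f zero + ∑ (λ i → f (suc i))

count : ∀ {n} → (Fin n → Bool) → ℕ
count p = ∑ (λ i → if p i then 1 else 0)

countEdges : ∀ {n} → (Fin n → Fin n → Bool) → ℕ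
countEdges e = ∑ (λ i → ∑ (λ j → if ⌊ i <? j ⌋ ∧ e i j then 1 else 0))

In₁ In₂ : ∀ {n} → (Fin n → Bool) → Fin n → Set
In₁ side i = side i ≡ false
In₂ side i = side i ≡ true

-- Edge 2-colourings: symmetric maps on vertex pairs (only values on edges matter).
EdgeColouring : ℕ → Set
EdgeColouring n = Σ (Fin n → Fin n → Bool) λ c → ∀ i j → c i j ≡ c j i

Adj : ∀ {n} → Graph n → Fin n → Fin n → Set
Adj G i j = adj G i j ≡ true

NotArrowsK3On : ∀ {n} → Graph n → (Fin n → Set) → Set
NotArrowsK3On G P = Σ (EdgeColouring _) λ cc → let c = Data.Product.proj₁ cc in
  ∀ a b d → P a → P b → P d →
  Adj G a b → Adj G b d → Adj G a d →
  ¬ (c a b ≡ c b d × c a b ≡ c a d)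

IsK4 : ∀ {n} → Graph n → Fin n → Fin n → Fin n → Fin n → Set
IsK4 G a b c d = Adj G a b × Adj G a c × Adj G a d × Adj G b c × Adj G b d × Adj G c d

NotVertexArrowsK4On : ∀ {n} → Graph n → (Fin n → Set) → Set
NotVertexArrowsK4On G P = Σ (_ → Bool) λ χ →
  ∀ a b c d → P a → P b → P c → P d → IsK4 G a b c d →
  ¬ (χ a ≡ χ b × χ a ≡ χ c × χ a ≡ χ d)

-- A subgraph H of G[P]: vertex set vs, edge set es (edges {i,j} read with i < j),
-- every edge of H joins vertices of H adjacent in G, and V(H) ⊆ P.
record SubgraphOn {n} (G : Graph n) (P : Fin n → Set) : Set where
  field
    vs : Fin n → Bool
    es : Fin n → Fin n → Bool
    vs⊆P : ∀ i → vs i ≡ true → P i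
    es⊆  : ∀ i j → es i j ≡ true → vs i ≡ true × vs j ≡ true × Adj G i j
open SubgraphOn public

∣V∣ : ∀ {n} {G : Graph n} {P} → SubgraphOn G P → ℕ
∣V∣ H = count (vs H)

∣E∣ : ∀ {n} {G : Graph n} {P} → SubgraphOn G P → ℕ
∣E∣ H = countEdges (es H)

-- ρ(H) = |E(H)|/|V(H)| ≥ 2 (H has at least one vertex)
DenseSmall : ∀ {n} {G : Graph n} {P} → SubgraphOn G P → Set
DenseSmall H = 1 ≤ ∣V∣ H × 2 * ∣V∣ H ≤ ∣E∣ H × ∣V∣ H ≤ 8

NotArrowsK4K4 : ∀ {n} → Graph n → Set
NotArrowsK4K4 G = Σ (EdgeColouring _) λ cc → let c = Data.Product.proj₁ cc in
  ∀ a b d e → IsK4 G a b d e →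
  ¬ (c a b ≡ c a d × c a b ≡ c a e × c a b ≡ c b d × c a b ≡ c b e × c a b ≡ c d e)

-- Colour the edges of G[V₁] by a colouring without monochromatic triangles, every V₁–V₂ edge by
-- the χ-colour of its end in V₂ (χ a vertex colouring of G[V₂] without monochromatic K₄), and an
-- edge of G[V₂] with equally χ-coloured ends by the other colour. A monochromatic K₄ of colour k
-- then lies inside V₂, and exactly one of its vertices, s, has χ-colour k: s is the apex of a split
-- K₄. An edge st of G[V₂] with χ s ≠ χ t gets the colour χ t whenever s, but not t, is the apex of
-- a split K₄ through st; so two more vertices t, u of our K₄ are apexes of split K₄'s through ts
-- and us. These three split K₄'s span at most 8 vertices and at least twice as many edges, which
-- G[V₂] does not allow.

module Submission where

open import Defs hiding (sym)
open import Data.Nat using (ℕ; zero; suc; _+_; _*_; _≤_; z≤n; s≤s)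
open import Data.Nat.Properties
  using (+-mono-≤; +-monoʳ-≤; +-identityʳ; +-assoc; ≤-trans; ≤-refl; n≤1+n; m≤m+n; m≤n+m;
         +-commutativeSemigroup; module ≤-Reasoning)
open import Data.Nat.ListAction using (sum)
open import Algebra.Properties.CommutativeSemigroup +-commutativeSemigroup using (interchange; x∙yz≈y∙xz)
open import Data.Bool using (Bool; true; false; not; _∧_; _xor_; if_then_else_)
import Data.Bool.Properties as Bool
open import Data.Bool.Properties using (∧-comm; not-¬; ¬-not; not-involutive)
open import Data.Fin using (Fin; zero; suc)
open import Data.Fin.Properties using (_≟_; _<?_; <-irrefl; <-asym; <-cmp; any?)
open import Data.List using (List; []; _∷_; map; _++_; length)
open import Data.List.Properties using (map-cong-local)
open import Data.List.Relation.Unary.All as All using (All; []; _∷_)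
open import Data.List.Relation.Unary.All.Properties using (All¬⇒¬Any)
open import Data.List.Relation.Unary.Any using (here; there)
open import Data.List.Relation.Unary.AllPairs using ([]; _∷_)
open import Data.List.Relation.Unary.Unique.Propositional using (Unique)
open import Data.List.Membership.Propositional using (_∈_)
open import Data.Empty using (⊥; ⊥-elim)
open import Data.Product using (_×_; _,_; proj₁; proj₂; ∃₂)
open import Function using (_∘_; case_of_)
open import Relation.Nullary using (¬_; Dec; does; yes; no)
open import Relation.Nullary.Decidable using (⌊_⌋; dec-true; dec-false; _×-dec_)
open import Relation.Binary using (tri<; tri≈; tri>)
open import Relation.Binary.PropositionalEquality

indicator : Bool → ℕ
indicator b = if b then 1 else 0

∑-cong : ∀ {n} {f g : Fin n → ℕ} → (∀ i → f i ≡ g i) → ∑ f ≡ ∑ g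
∑-cong {zero}  f≗g = refl
∑-cong {suc n} f≗g = cong₂ _+_ (f≗g zero) (∑-cong (λ i → f≗g (suc i)))

∑-zero : ∀ {n} → ∑ {n} (λ _ → 0) ≡ 0
∑-zero {zero}  = refl
∑-zero {suc n} = ∑-zero {n}

erase : ∀ {n} → Fin n → (Fin n → ℕ) → Fin n → ℕ
erase x f i = if does (i ≟ x) then 0 else f i

∑-erase : ∀ {n} (x : Fin n) (f : Fin n → ℕ) → ∑ f ≡ f x + ∑ (erase x f)
∑-erase zero    f = refl
∑-erase (suc x) f = begin
  f zero + ∑ (λ i → f (suc i))                          ≡⟨ cong (f zero +_) (∑-erase x (λ i → f (suc i))) ⟩
  f zero + (f (suc x) + ∑ (erase x (λ i → f (suc i))))  ≡⟨ x∙yz≈y∙xz (f zero) (f (suc x)) _ ⟩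
  f (suc x) + ∑ (erase (suc x) f)                       ∎
  where open ≡-Reasoning

sum-unique≤∑ : ∀ {n} (f : Fin n → ℕ) {xs : List (Fin n)} → Unique xs → sum (map f xs) ≤ ∑ f
sum-unique≤∑ f {[]}     []              = z≤n
sum-unique≤∑ f {x ∷ xs} (x∉xs ∷ unique) = begin
  f x + sum (map f xs)            ≡⟨ cong (λ ys → f x + sum ys) (map-cong-local (All.map erase-other x∉xs)) ⟩
  f x + sum (map (erase x f) xs)  ≤⟨ +-monoʳ-≤ (f x) (sum-unique≤∑ (erase x f) unique) ⟩
  f x + ∑ (erase x f)             ≡⟨ ∑-erase x f ⟨
  ∑ f                             ∎
  where
  open ≤-Reasoning
  erase-other : ∀ {j} → x ≢ j → f j ≡ erase x f j
  erase-other {j} x≢j rewrite dec-false (j ≟ x) (x≢j ∘ sym) = refl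

sum-map-+ : ∀ {A : Set} (f g : A → ℕ) xs → sum (map (λ x → f x + g x) xs) ≡ sum (map f xs) + sum (map g xs)
sum-map-+ f g []       = refl
sum-map-+ f g (x ∷ xs) = trans (cong (f x + g x +_) (sum-map-+ f g xs)) (interchange (f x) (g x) _ _)

sum-map-mono : ∀ {A : Set} {f g : A → ℕ} → (∀ x → f x ≤ g x) → ∀ xs → sum (map f xs) ≤ sum (map g xs)
sum-map-mono f≤g []       = z≤n
sum-map-mono f≤g (x ∷ xs) = +-mono-≤ (f≤g x) (sum-map-mono f≤g xs)

trues : List Bool → ℕ
trues bs = sum (map indicator bs)

trues-map-++ : ∀ {A : Set} (f : A → Bool) xs bs → trues (map f xs ++ bs) ≡ sum (map (indicator ∘ f) xs) + trues bs
trues-map-++ f []       bs = refl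
trues-map-++ f (x ∷ xs) bs =
  trans (cong (indicator (f x) +_) (trues-map-++ f xs bs)) (sym (+-assoc (indicator (f x)) _ _))

infixr 5 _✓_ ✗_

data AtLeastTrue : ℕ → List Bool → Set where
  []  : ∀ {bs} → AtLeastTrue 0 bs
  _✓_ : ∀ {m b bs} → b ≡ true → AtLeastTrue m bs → AtLeastTrue (suc m) (b ∷ bs)
  ✗_  : ∀ {m b bs} → AtLeastTrue m bs → AtLeastTrue m (b ∷ bs)

atLeastTrue⇒≤trues : ∀ {m bs} → AtLeastTrue m bs → m ≤ trues bs
atLeastTrue⇒≤trues []                = z≤n
atLeastTrue⇒≤trues (refl ✓ rest)     = s≤s (atLeastTrue⇒≤trues rest)
atLeastTrue⇒≤trues (✗_ {b = b} rest) = ≤-trans (atLeastTrue⇒≤trues rest) (m≤n+m _ (indicator b))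

from-does : ∀ {A : Set} (a? : Dec A) → does a? ≡ true → A
from-does (yes a) _ = a
from-does (no _)  ()

∧-true : ∀ {a b} → a ∧ b ≡ true → a ≡ true × b ≡ true
∧-true {true} b≡true = refl , b≡true

module _ {n : ℕ} (e : Fin n → Fin n → Bool) where

  adjacencies : List (Fin n) → List Bool
  adjacencies []       = []
  adjacencies (x ∷ xs) = map (e x) xs ++ adjacencies xs

  oriented : Fin n → Fin n → ℕ
  oriented i j = if ⌊ i <? j ⌋ ∧ e i j then 1 else 0

  oriented-irrefl : ∀ i → oriented i i ≡ 0
  oriented-irrefl i with i <? i
  ... | yes i<i = ⊥-elim (<-irrefl refl i<i)
  ... | no  _   = refl

  oriented-both : (∀ i j → e i j ≡ e j i) → ∀ {i j} → i ≢ j → oriented i j + oriented j i ≡ indicator (e i j)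
  oriented-both e-sym {i} {j} i≢j with i <? j | j <? i
  ... | yes i<j | yes j<i = ⊥-elim (<-asym i<j j<i)
  ... | yes _   | no  _   = +-identityʳ _
  ... | no  _   | yes _   = cong indicator (e-sym j i)
  ... | no  i≮j | no  j≮i with <-cmp i j
  ...   | tri< i<j _ _ = ⊥-elim (i≮j i<j)
  ...   | tri≈ _ i≡j _ = ⊥-elim (i≢j i≡j)
  ...   | tri> _ _ j<i = ⊥-elim (j≮i j<i)

  sum-oriented≡trues-adjacencies : (∀ i j → e i j ≡ e j i) → ∀ {xs} → Unique xs →
    sum (map (λ i → sum (map (oriented i) xs)) xs) ≡ trues (adjacencies xs)
  sum-oriented≡trues-adjacencies e-sym {[]}     []              = refl
  sum-oriented≡trues-adjacencies e-sym {x ∷ xs} (x∉xs ∷ unique) = begin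
    (oriented x x + sum (map (oriented x) xs)) + sum (map (λ i → oriented i x + S i) xs)
      ≡⟨ cong₂ _+_ (cong (_+ sum (map (oriented x) xs)) (oriented-irrefl x))
                   (sum-map-+ (λ i → oriented i x) S xs) ⟩
    sum (map (oriented x) xs) + (sum (map (λ i → oriented i x) xs) + sum (map S xs))
      ≡⟨ +-assoc (sum (map (oriented x) xs)) _ _ ⟨
    (sum (map (oriented x) xs) + sum (map (λ i → oriented i x) xs)) + sum (map S xs)
      ≡⟨ cong (_+ sum (map S xs)) (sum-map-+ (oriented x) (λ i → oriented i x) xs) ⟨
    sum (map (λ j → oriented x j + oriented j x) xs) + sum (map S xs)
      ≡⟨ cong₂ _+_ (cong sum (map-cong-local (All.map (oriented-both e-sym) x∉xs)))
                   (sum-oriented≡trues-adjacencies e-sym unique) ⟩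
    sum (map (indicator ∘ e x) xs) + trues (adjacencies xs)
      ≡⟨ trues-map-++ (e x) xs (adjacencies xs) ⟨
    trues (adjacencies (x ∷ xs))
      ∎
    where
    open ≡-Reasoning
    S : Fin n → ℕ
    S i = sum (map (oriented i) xs)

  adjacencies≤countEdges : (∀ i j → e i j ≡ e j i) → ∀ {xs} → Unique xs → trues (adjacencies xs) ≤ countEdges e
  adjacencies≤countEdges e-sym {xs} unique = begin
    trues (adjacencies xs)                          ≡⟨ sum-oriented≡trues-adjacencies e-sym unique ⟨
    sum (map (λ i → sum (map (oriented i) xs)) xs)  ≤⟨ sum-map-mono (λ i → sum-unique≤∑ (oriented i) unique) xs ⟩
    sum (map (λ i → ∑ (oriented i)) xs)             ≤⟨ sum-unique≤∑ (λ i → ∑ (oriented i)) unique ⟩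
    countEdges e                                    ∎
    where open ≤-Reasoning

adjacencies-cong : ∀ {n} {e e′ : Fin n → Fin n → Bool} xs → (∀ {i j} → i ∈ xs → j ∈ xs → e i j ≡ e′ i j) →
  adjacencies e xs ≡ adjacencies e′ xs
adjacencies-cong []       e≗e′ = refl
adjacencies-cong (x ∷ xs) e≗e′ = cong₂ _++_
  (map-cong-local (All.tabulate λ j∈xs → e≗e′ (here refl) (there j∈xs)))
  (adjacencies-cong xs λ i∈xs j∈xs → e≗e′ (there i∈xs) (there j∈xs))

module _ {n : ℕ} where
  open import Data.List.Membership.DecPropositional (_≟_ {n}) using (_∈?_)

  count-∈?-unique : ∀ {xs : List (Fin n)} → Unique xs → count (λ i → does (i ∈? xs)) ≡ length xs
  count-∈?-unique {[]}     []              = ∑-zero {n}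
  count-∈?-unique {x ∷ xs} (x∉xs ∷ unique) = begin
    count (λ i → does (i ∈? (x ∷ xs)))
      ≡⟨ ∑-erase x (λ i → indicator (does (i ∈? (x ∷ xs)))) ⟩
    indicator (does (x ∈? (x ∷ xs))) + ∑ (erase x (λ i → indicator (does (i ∈? (x ∷ xs)))))
      ≡⟨ cong₂ _+_ (cong indicator (dec-true (x ∈? (x ∷ xs)) (here refl))) (∑-cong erase-head) ⟩
    1 + count (λ i → does (i ∈? xs))
      ≡⟨ cong suc (count-∈?-unique unique) ⟩
    suc (length xs)
      ∎
    where
    open ≡-Reasoning
    erase-head : ∀ i → erase x (λ i → indicator (does (i ∈? (x ∷ xs)))) i ≡ indicator (does (i ∈? xs))
    erase-head i with i ≟ x
    ... | yes refl = cong indicator (sym (dec-false (x ∈? xs) (All¬⇒¬Any x∉xs)))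
    ... | no  _    = refl

  module _ (G : Graph n) {P : Fin n → Set} where

    induced : (xs : List (Fin n)) → All P xs → SubgraphOn G P
    induced xs xs⊆P = record
      { vs   = λ i → does (i ∈? xs)
      ; es   = λ i j → (does (i ∈? xs) ∧ does (j ∈? xs)) ∧ adj G i j
      ; vs⊆P = λ i i∈xs → All.lookup xs⊆P (from-does (i ∈? xs) i∈xs)
      ; es⊆  = λ i j ij → let (i,j∈xs , ij) = ∧-true ij ; (i∈xs , j∈xs) = ∧-true i,j∈xs in i∈xs , j∈xs , ij
      }

    induced-denseSmall : ∀ {xs} (xs⊆P : All P xs) → Unique xs → 1 ≤ length xs → length xs ≤ 8 →
      2 * length xs ≤ trues (adjacencies (adj G) xs) → DenseSmall (induced xs xs⊆P)
    induced-denseSmall {xs} xs⊆P unique 1≤∣xs∣ ∣xs∣≤8 dense =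
      subst (1 ≤_) (sym ∣V∣≡∣xs∣) 1≤∣xs∣ , 2∣V∣≤∣E∣ , subst (_≤ 8) (sym ∣V∣≡∣xs∣) ∣xs∣≤8
      where
      H : SubgraphOn G P
      H = induced xs xs⊆P
      ∣V∣≡∣xs∣ : ∣V∣ H ≡ length xs
      ∣V∣≡∣xs∣ = count-∈?-unique unique
      es-sym : ∀ i j → es H i j ≡ es H j i
      es-sym i j = cong₂ _∧_ (∧-comm (does (i ∈? xs)) _) (Graph.sym G i j)
      es≗adj : ∀ {i j} → i ∈ xs → j ∈ xs → es H i j ≡ adj G i j
      es≗adj {i} {j} i∈xs j∈xs rewrite dec-true (i ∈? xs) i∈xs | dec-true (j ∈? xs) j∈xs = refl
      2∣V∣≤∣E∣ : 2 * ∣V∣ H ≤ ∣E∣ H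
      2∣V∣≤∣E∣ = begin
        2 * ∣V∣ H                       ≡⟨ cong (2 *_) ∣V∣≡∣xs∣ ⟩
        2 * length xs                   ≤⟨ dense ⟩
        trues (adjacencies (adj G) xs)  ≡⟨ cong trues (adjacencies-cong xs es≗adj) ⟨
        trues (adjacencies (es H) xs)   ≤⟨ adjacencies≤countEdges (es H) es-sym unique ⟩
        ∣E∣ H                           ∎
        where open ≤-Reasoning

-- The colour of an edge ij of G[V₂], where σ = χ i, τ = χ j and αᵢ (αⱼ) says whether i (j) is the
-- apex of a split K₄ through ij. For σ ≠ τ it is true iff the false-coloured end is an apex, hence
-- the χ-colour of the non-apex end whenever exactly one end is an apex.
edgeColour₂ : (σ τ αᵢ αⱼ : Bool) → Bool
edgeColour₂ true  true  _  _  = false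
edgeColour₂ false false _  _  = true
edgeColour₂ true  false _  αⱼ = αⱼ
edgeColour₂ false true  αᵢ _  = αᵢ

edgeColour₂-sym : ∀ σ τ α β → edgeColour₂ σ τ α β ≡ edgeColour₂ τ σ β α
edgeColour₂-sym true  true  _ _ = refl
edgeColour₂-sym false false _ _ = refl
edgeColour₂-sym true  false _ _ = refl
edgeColour₂-sym false true  _ _ = refl

edgeColour₂-same : ∀ σ α β → edgeColour₂ σ σ α β ≡ not σ
edgeColour₂-same true  _ _ = refl
edgeColour₂-same false _ _ = refl

edgeColour₂-apex : ∀ τ β → edgeColour₂ (not τ) τ true β ≡ not τ → β ≡ true
edgeColour₂-apex false β β≡true = β≡true
edgeColour₂-apex true  β ()

module Construction {n : ℕ} (G : Graph n) (side : Fin n → Bool)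
  (edge₁ : NotArrowsK3On G (In₁ side)) (vertex₂ : NotVertexArrowsK4On G (In₂ side))
  (sparse : (H : SubgraphOn G (In₂ side)) → ¬ DenseSmall H) where

  c₁ : Fin n → Fin n → Bool
  c₁ = proj₁ (proj₁ edge₁)

  χ : Fin n → Bool
  χ = proj₁ vertex₂

  Adj-sym : ∀ {i j} → Adj G i j → Adj G j i
  Adj-sym {i} {j} ij = trans (Graph.sym G j i) ij

  Adj⇒≢ : ∀ {i j} → Adj G i j → i ≢ j
  Adj⇒≢ {i} ii refl = case trans (sym ii) (irrefl G i) of λ ()

  χ-apart : ∀ {s t i j} → χ s ≡ not (χ t) → χ i ≡ χ t → χ j ≡ χ s → i ≢ j
  χ-apart χs χi χj refl = not-¬ χi (trans χj χs)

  SplitK4 : Fin n → Fin n → Fin n → Fin n → Set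
  SplitK4 s t a b = All (In₂ side) (s ∷ t ∷ a ∷ b ∷ []) × IsK4 G s t a b ×
                    χ a ≡ χ t × χ b ≡ χ t × χ s ≡ not (χ t)

  SplitK4-swap : ∀ {s t a b} → SplitK4 s t a b → SplitK4 s t b a
  SplitK4-swap (s₂ ∷ t₂ ∷ a₂ ∷ b₂ ∷ [] , (st , sa , sb , ta , tb , ab) , χa , χb , χs) =
    s₂ ∷ t₂ ∷ b₂ ∷ a₂ ∷ [] , (st , sb , sa , tb , ta , Adj-sym ab) , χb , χa , χs

  splitK4? : ∀ s t a b → Dec (SplitK4 s t a b)
  splitK4? s t a b =
    All.all? (λ i → side i Bool.≟ true) _ ×-dec
    (adj? s t ×-dec adj? s a ×-dec adj? s b ×-dec adj? t a ×-dec adj? t b ×-dec adj? a b) ×-dec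
    χ a Bool.≟ χ t ×-dec χ b Bool.≟ χ t ×-dec χ s Bool.≟ not (χ t)
    where
    adj? : ∀ i j → Dec (Adj G i j)
    adj? i j = adj G i j Bool.≟ true

  apex : Fin n → Fin n → Bool
  apex s t = does (any? λ a → any? λ b → splitK4? s t a b)

  apex-intro : ∀ {s t a b} → SplitK4 s t a b → apex s t ≡ true
  apex-intro {s} {t} {a} {b} K = dec-true (any? λ a → any? λ b → splitK4? s t a b) (a , b , K)

  apex-elim : ∀ {s t} → apex s t ≡ true → ∃₂ (SplitK4 s t)
  apex-elim {s} {t} = from-does (any? λ a → any? λ b → splitK4? s t a b)

  colourBySide : Bool → Bool → Fin n → Fin n → Bool
  colourBySide false false i j = c₁ i j
  colourBySide false true  i j = χ j
  colourBySide true  false i j = χ i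
  colourBySide true  true  i j = edgeColour₂ (χ i) (χ j) (apex i j) (apex j i)

  colour : Fin n → Fin n → Bool
  colour i j = colourBySide (side i) (side j) i j

  colour-sym : ∀ i j → colour i j ≡ colour j i
  colour-sym i j = bySide (side i) (side j)
    where
    bySide : ∀ σ τ → colourBySide σ τ i j ≡ colourBySide τ σ j i
    bySide false false = proj₂ (proj₁ edge₁) i j
    bySide false true  = refl
    bySide true  false = refl
    bySide true  true  = edgeColour₂-sym (χ i) (χ j) (apex i j) (apex j i)

  colour-₁₁ : ∀ {i j} → In₁ side i → In₁ side j → colour i j ≡ c₁ i j
  colour-₁₁ {i} {j} i₁ j₁ = cong₂ (λ σ τ → colourBySide σ τ i j) i₁ j₁

  colour-₂₁ : ∀ {i j} → In₂ side i → In₁ side j → colour i j ≡ χ i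
  colour-₂₁ {i} {j} i₂ j₁ = cong₂ (λ σ τ → colourBySide σ τ i j) i₂ j₁

  colour-₂₂ : ∀ {i j} → In₂ side i → In₂ side j → colour i j ≡ edgeColour₂ (χ i) (χ j) (apex i j) (apex j i)
  colour-₂₂ {i} {j} i₂ j₂ = cong₂ (λ σ τ → colourBySide σ τ i j) i₂ j₂

  colour-monochromatic : ∀ {i j} → In₂ side i → In₂ side j → χ i ≡ χ j → colour i j ≡ not (χ i)
  colour-monochromatic {i} {j} i₂ j₂ χi≡χj = begin
    colour i j                                     ≡⟨ colour-₂₂ i₂ j₂ ⟩
    edgeColour₂ (χ i) (χ j) (apex i j) (apex j i)  ≡⟨ cong (λ τ → edgeColour₂ (χ i) τ (apex i j) (apex j i)) χi≡χj ⟨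
    edgeColour₂ (χ i) (χ i) (apex i j) (apex j i)  ≡⟨ edgeColour₂-same (χ i) _ _ ⟩
    not (χ i)                                      ∎
    where open ≡-Reasoning

  apex-forced : ∀ {s t a b} → SplitK4 s t a b → colour s t ≡ χ s → apex t s ≡ true
  apex-forced {s} {t} K@(s₂ ∷ t₂ ∷ _ , _ , _ , _ , χs) st≡χs = edgeColour₂-apex (χ t) (apex t s) (begin
    edgeColour₂ (not (χ t)) (χ t) true (apex t s)  ≡⟨ cong₂ (λ σ α → edgeColour₂ σ (χ t) α (apex t s)) χs (apex-intro K) ⟨
    edgeColour₂ (χ s) (χ t) (apex s t) (apex t s)  ≡⟨ colour-₂₂ s₂ t₂ ⟨
    colour s t                                     ≡⟨ st≡χs ⟩
    χ s                                            ≡⟨ χs ⟩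
    not (χ t)                                      ∎)
    where open ≡-Reasoning

  sparse-induced : ∀ {xs} → All (In₂ side) xs → Unique xs → 1 ≤ length xs → length xs ≤ 8 →
    ¬ (2 * length xs ≤ trues (adjacencies (adj G) xs))
  sparse-induced V₂ unique 1≤∣xs∣ ∣xs∣≤8 =
    sparse (induced G _ V₂) ∘ induced-denseSmall G V₂ unique 1≤∣xs∣ ∣xs∣≤8

  dense₆ : ∀ {s t u v x y} → SplitK4 s t u v → SplitK4 t s x y → SplitK4 u s x y → ⊥
  dense₆ {s} {t} {u} {v} {x} {y}
         (s₂ ∷ t₂ ∷ u₂ ∷ v₂ ∷ [] , (st , su , sv , tu , tv , uv) , χu , χv , χs)
         (_ ∷ _ ∷ x₂ ∷ y₂ ∷ [] , (_ , tx , ty , sx , sy , xy) , χx , χy , _)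
         (_ ∷ _ ∷ _ ∷ _ ∷ [] , (_ , ux , uy , _ , _ , _) , _ , _ , _) =
    sparse-induced {vertices}
      (s₂ ∷ t₂ ∷ u₂ ∷ v₂ ∷ x₂ ∷ y₂ ∷ []) unique (s≤s z≤n) (m≤m+n 6 2)
      (≤-trans (n≤1+n 12) (atLeastTrue⇒≤trues edges))
    where
    vertices : List (Fin n)
    vertices = s ∷ t ∷ u ∷ v ∷ x ∷ y ∷ []
    apart : ∀ {i j} → χ i ≡ χ t → χ j ≡ χ s → i ≢ j
    apart = χ-apart χs
    unique : Unique vertices
    unique = (Adj⇒≢ st ∷ Adj⇒≢ su ∷ Adj⇒≢ sv ∷ Adj⇒≢ sx ∷ Adj⇒≢ sy ∷ [])
           ∷ (Adj⇒≢ tu ∷ Adj⇒≢ tv ∷ Adj⇒≢ tx ∷ Adj⇒≢ ty ∷ [])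
           ∷ (Adj⇒≢ uv ∷ Adj⇒≢ ux ∷ Adj⇒≢ uy ∷ [])
           ∷ (apart χv χx ∷ apart χv χy ∷ [])
           ∷ (Adj⇒≢ xy ∷ [])
           ∷ [] ∷ []
    edges : AtLeastTrue 13 (adjacencies (adj G) vertices)
    edges = st ✓ su ✓ sv ✓ sx ✓ sy ✓
            tu ✓ tv ✓ tx ✓ ty ✓
            uv ✓ ux ✓ uy ✓
            ✗ ✗
            xy ✓ []

  dense₇ : ∀ {s t u v x y q} → SplitK4 s t u v → SplitK4 t s x y → SplitK4 u s x q → y ≢ q → ⊥
  dense₇ {s} {t} {u} {v} {x} {y} {q}
         (s₂ ∷ t₂ ∷ u₂ ∷ v₂ ∷ [] , (st , su , sv , tu , tv , uv) , χu , χv , χs)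
         (_ ∷ _ ∷ x₂ ∷ y₂ ∷ [] , (_ , tx , ty , sx , sy , xy) , χx , χy , _)
         (_ ∷ _ ∷ _ ∷ q₂ ∷ [] , (_ , ux , uq , _ , sq , xq) , _ , χq , _) y≢q =
    sparse-induced {vertices}
      (s₂ ∷ t₂ ∷ u₂ ∷ v₂ ∷ x₂ ∷ y₂ ∷ q₂ ∷ []) unique (s≤s z≤n) (m≤m+n 7 1)
      (≤-trans (n≤1+n 14) (atLeastTrue⇒≤trues edges))
    where
    vertices : List (Fin n)
    vertices = s ∷ t ∷ u ∷ v ∷ x ∷ y ∷ q ∷ []
    apart : ∀ {i j} → χ i ≡ χ t → χ j ≡ χ s → i ≢ j
    apart = χ-apart χs
    unique : Unique vertices
    unique = (Adj⇒≢ st ∷ Adj⇒≢ su ∷ Adj⇒≢ sv ∷ Adj⇒≢ sx ∷ Adj⇒≢ sy ∷ Adj⇒≢ sq ∷ [])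
           ∷ (Adj⇒≢ tu ∷ Adj⇒≢ tv ∷ Adj⇒≢ tx ∷ Adj⇒≢ ty ∷ apart refl χq ∷ [])
           ∷ (Adj⇒≢ uv ∷ Adj⇒≢ ux ∷ apart χu χy ∷ Adj⇒≢ uq ∷ [])
           ∷ (apart χv χx ∷ apart χv χy ∷ apart χv χq ∷ [])
           ∷ (Adj⇒≢ xy ∷ Adj⇒≢ xq ∷ [])
           ∷ (y≢q ∷ [])
           ∷ [] ∷ []
    edges : AtLeastTrue 15 (adjacencies (adj G) vertices)
    edges = st ✓ su ✓ sv ✓ sx ✓ sy ✓ sq ✓
            tu ✓ tv ✓ tx ✓ ty ✓ ✗
            uv ✓ ux ✓ ✗ uq ✓
            ✗ ✗ ✗
            xy ✓ xq ✓ []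

  dense₈ : ∀ {s t u v x y p q} → SplitK4 s t u v → SplitK4 t s x y → SplitK4 u s p q →
    x ≢ p → x ≢ q → y ≢ p → y ≢ q → ⊥
  dense₈ {s} {t} {u} {v} {x} {y} {p} {q}
         (s₂ ∷ t₂ ∷ u₂ ∷ v₂ ∷ [] , (st , su , sv , tu , tv , uv) , χu , χv , χs)
         (_ ∷ _ ∷ x₂ ∷ y₂ ∷ [] , (_ , tx , ty , sx , sy , xy) , χx , χy , _)
         (_ ∷ _ ∷ p₂ ∷ q₂ ∷ [] , (_ , up , uq , sp , sq , pq) , χp , χq , _) x≢p x≢q y≢p y≢q =
    sparse-induced {vertices}
      (s₂ ∷ t₂ ∷ u₂ ∷ v₂ ∷ x₂ ∷ y₂ ∷ p₂ ∷ q₂ ∷ []) unique (s≤s z≤n) ≤-refl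
      (atLeastTrue⇒≤trues edges)
    where
    vertices : List (Fin n)
    vertices = s ∷ t ∷ u ∷ v ∷ x ∷ y ∷ p ∷ q ∷ []
    apart : ∀ {i j} → χ i ≡ χ t → χ j ≡ χ s → i ≢ j
    apart = χ-apart χs
    unique : Unique vertices
    unique = (Adj⇒≢ st ∷ Adj⇒≢ su ∷ Adj⇒≢ sv ∷ Adj⇒≢ sx ∷ Adj⇒≢ sy ∷ Adj⇒≢ sp ∷ Adj⇒≢ sq ∷ [])
           ∷ (Adj⇒≢ tu ∷ Adj⇒≢ tv ∷ Adj⇒≢ tx ∷ Adj⇒≢ ty ∷ apart refl χp ∷ apart refl χq ∷ [])
           ∷ (Adj⇒≢ uv ∷ apart χu χx ∷ apart χu χy ∷ Adj⇒≢ up ∷ Adj⇒≢ uq ∷ [])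
           ∷ (apart χv χx ∷ apart χv χy ∷ apart χv χp ∷ apart χv χq ∷ [])
           ∷ (Adj⇒≢ xy ∷ x≢p ∷ x≢q ∷ [])
           ∷ (y≢p ∷ y≢q ∷ [])
           ∷ (Adj⇒≢ pq ∷ [])
           ∷ [] ∷ []
    edges : AtLeastTrue 16 (adjacencies (adj G) vertices)
    edges = st ✓ su ✓ sv ✓ sx ✓ sy ✓ sp ✓ sq ✓
            tu ✓ tv ✓ tx ✓ ty ✓ ✗ ✗
            uv ✓ ✗ ✗ up ✓ uq ✓
            ✗ ✗ ✗ ✗
            xy ✓ ✗ ✗
            ✗ ✗
            pq ✓ []

  -- The three split K₄'s on {s,t,u,v}, {t,s,x,y}, {u,s,p,q} share k = |{x,y} ∩ {p,q}| further
  -- vertices: they span 8 − k vertices and 16 − k (k < 2) or 13 (k = 2) edges.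
  no-double-apex : ∀ {s t u v} → SplitK4 s t u v → apex t s ≡ true → apex u s ≡ true → ⊥
  no-double-apex K₁ ts us with apex-elim ts | apex-elim us
  ... | x , y , K₂ | p , q , K₃ with p ≟ x | p ≟ y | q ≟ x | q ≟ y
  ... | yes refl | _        | _        | yes refl = dense₆ K₁ K₂ K₃
  ... | yes refl | _        | _        | no q≢y   = dense₇ K₁ K₂ K₃ (q≢y ∘ sym)
  ... | no _     | yes refl | yes refl | _        = dense₆ K₁ K₂ (SplitK4-swap K₃)
  ... | no _     | yes refl | no q≢x   | _        = dense₇ K₁ (SplitK4-swap K₂) K₃ (q≢x ∘ sym)
  ... | no _     | no p≢y   | yes refl | _        = dense₇ K₁ K₂ (SplitK4-swap K₃) (p≢y ∘ sym)
  ... | no p≢x   | no _     | no _     | yes refl = dense₇ K₁ (SplitK4-swap K₂) (SplitK4-swap K₃) (p≢x ∘ sym)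
  ... | no p≢x   | no p≢y   | no q≢x   | no q≢y   = dense₈ K₁ K₂ K₃ (p≢x ∘ sym) (q≢x ∘ sym) (p≢y ∘ sym) (q≢y ∘ sym)

  MonoEdge : Bool → Fin n → Fin n → Set
  MonoEdge k i j = Adj G i j × colour i j ≡ k

  MonoEdge-sym : ∀ {k i j} → MonoEdge k i j → MonoEdge k j i
  MonoEdge-sym {i = i} {j} (ij , ij≡k) = Adj-sym ij , trans (colour-sym j i) ij≡k

  MonoEdge-χ-opposite : ∀ {k i j} → In₂ side i → In₂ side j → MonoEdge k i j → χ i ≡ k → χ j ≡ not k
  MonoEdge-χ-opposite {k} {i} {j} i₂ j₂ (_ , ij≡k) χi≡k = ¬-not λ χj≡k → not-¬ refl (begin
    k           ≡⟨ ij≡k ⟨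
    colour i j  ≡⟨ colour-monochromatic i₂ j₂ (trans χi≡k (sym χj≡k)) ⟩
    not (χ i)   ≡⟨ cong not χi≡k ⟩
    not k       ∎)
    where open ≡-Reasoning

  MonoK4 : Bool → Fin n → Fin n → Fin n → Fin n → Set
  MonoK4 k a b c d = MonoEdge k a b × MonoEdge k a c × MonoEdge k a d ×
                     MonoEdge k b c × MonoEdge k b d × MonoEdge k c d

  MonoK4-swap₁₂ : ∀ {k a b c d} → MonoK4 k a b c d → MonoK4 k b a c d
  MonoK4-swap₁₂ (ab , ac , ad , bc , bd , cd) = MonoEdge-sym ab , bc , bd , ac , ad , cd

  MonoK4-swap₂₃ : ∀ {k a b c d} → MonoK4 k a b c d → MonoK4 k a c b d
  MonoK4-swap₂₃ (ab , ac , ad , bc , bd , cd) = ac , ab , ad , MonoEdge-sym bc , cd , bd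

  MonoK4-swap₃₄ : ∀ {k a b c d} → MonoK4 k a b c d → MonoK4 k a b d c
  MonoK4-swap₃₄ (ab , ac , ad , bc , bd , cd) = ab , ad , ac , bd , bc , MonoEdge-sym cd

  MonoK4⇒IsK4 : ∀ {k a b c d} → MonoK4 k a b c d → IsK4 G a b c d
  MonoK4⇒IsK4 ((ab , _) , (ac , _) , (ad , _) , (bc , _) , (bd , _) , (cd , _)) = ab , ac , ad , bc , bd , cd

  monoK4⇒splitK4 : ∀ {k s t u v} → In₂ side s → In₂ side t → In₂ side u → In₂ side v →
    MonoK4 k s t u v → χ s ≡ k → SplitK4 s t u v
  monoK4⇒splitK4 {k} {s} {t} {u} {v} s₂ t₂ u₂ v₂ K@(st , su , sv , _) χs≡k =
    s₂ ∷ t₂ ∷ u₂ ∷ v₂ ∷ [] , MonoK4⇒IsK4 K ,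
    trans χu (sym χt) , trans χv (sym χt) , trans χs≡k (trans (sym (not-involutive k)) (cong not (sym χt)))
    where
    χt : χ t ≡ not k
    χt = MonoEdge-χ-opposite s₂ t₂ st χs≡k
    χu : χ u ≡ not k
    χu = MonoEdge-χ-opposite s₂ u₂ su χs≡k
    χv : χ v ≡ not k
    χv = MonoEdge-χ-opposite s₂ v₂ sv χs≡k

  no-monoK4-apex : ∀ {k s t u v} → In₂ side s → In₂ side t → In₂ side u → In₂ side v →
    MonoK4 k s t u v → χ s ≡ k → ⊥
  no-monoK4-apex {s = s} {t} {u} {v} s₂ t₂ u₂ v₂ K@((_ , st≡k) , (_ , su≡k) , _) χs≡k =
    no-double-apex K₁ (apex-forced K₁ (trans st≡k (sym χs≡k))) (apex-forced K₁′ (trans su≡k (sym χs≡k)))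
    where
    K₁ : SplitK4 s t u v
    K₁ = monoK4⇒splitK4 s₂ t₂ u₂ v₂ K χs≡k
    K₁′ : SplitK4 s u t v
    K₁′ = monoK4⇒splitK4 s₂ u₂ t₂ v₂ (MonoK4-swap₂₃ K) χs≡k

  no-monoK4-inV₂ : ∀ {k a b c d} → In₂ side a → In₂ side b → In₂ side c → In₂ side d → MonoK4 k a b c d → ⊥
  no-monoK4-inV₂ {k} {a} {b} {c} {d} a₂ b₂ c₂ d₂ K with χ a Bool.≟ k | χ b Bool.≟ k | χ c Bool.≟ k | χ d Bool.≟ k
  ... | yes χa | _      | _      | _      = no-monoK4-apex a₂ b₂ c₂ d₂ K χa
  ... | no _   | yes χb | _      | _      = no-monoK4-apex b₂ a₂ c₂ d₂ (MonoK4-swap₁₂ K) χb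
  ... | no _   | no _   | yes χc | _      = no-monoK4-apex c₂ a₂ b₂ d₂ (MonoK4-swap₁₂ (MonoK4-swap₂₃ K)) χc
  ... | no _   | no _   | no _   | yes χd =
    no-monoK4-apex d₂ a₂ b₂ c₂ (MonoK4-swap₁₂ (MonoK4-swap₂₃ (MonoK4-swap₃₄ K))) χd
  ... | no χa  | no χb  | no χc  | no χd  = proj₂ vertex₂ a b c d a₂ b₂ c₂ d₂ (MonoK4⇒IsK4 K)
    (trans (¬-not χa) (sym (¬-not χb)) , trans (¬-not χa) (sym (¬-not χc)) , trans (¬-not χa) (sym (¬-not χd)))

  no-monoTriangle-₁₁₁ : ∀ {k p q r} → In₁ side p → In₁ side q → In₁ side r →
    MonoEdge k p q → MonoEdge k p r → MonoEdge k q r → ⊥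
  no-monoTriangle-₁₁₁ {k} {p} {q} {r} p₁ q₁ r₁ (pq , pq≡k) (pr , pr≡k) (qr , qr≡k) =
    proj₂ edge₁ p q r p₁ q₁ r₁ pq qr pr (trans c₁pq≡k (sym c₁qr≡k) , trans c₁pq≡k (sym c₁pr≡k))
    where
    c₁pq≡k : c₁ p q ≡ k
    c₁pq≡k = trans (sym (colour-₁₁ p₁ q₁)) pq≡k
    c₁pr≡k : c₁ p r ≡ k
    c₁pr≡k = trans (sym (colour-₁₁ p₁ r₁)) pr≡k
    c₁qr≡k : c₁ q r ≡ k
    c₁qr≡k = trans (sym (colour-₁₁ q₁ r₁)) qr≡k

  no-monoTriangle-₂₂₁ : ∀ {k u v w} → In₂ side u → In₂ side v → In₁ side w →
    MonoEdge k u v → MonoEdge k u w → MonoEdge k v w → ⊥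
  no-monoTriangle-₂₂₁ u₂ v₂ w₁ uv (_ , uw≡k) (_ , vw≡k) =
    not-¬ (trans (sym (colour-₂₁ v₂ w₁)) vw≡k) (MonoEdge-χ-opposite u₂ v₂ uv (trans (sym (colour-₂₁ u₂ w₁)) uw≡k))

  no-monoTriangle-even : ∀ {k p q r σ τ ρ} → side p ≡ σ → side q ≡ τ → side r ≡ ρ → σ xor τ xor ρ ≡ false →
    MonoEdge k p q → MonoEdge k p r → MonoEdge k q r → ⊥
  no-monoTriangle-even {σ = false} {false} {false} p₁ q₁ r₁ _ pq pr qr = no-monoTriangle-₁₁₁ p₁ q₁ r₁ pq pr qr
  no-monoTriangle-even {σ = true}  {true}  {false} p₂ q₂ r₁ _ pq pr qr = no-monoTriangle-₂₂₁ p₂ q₂ r₁ pq pr qr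
  no-monoTriangle-even {σ = true}  {false} {true}  p₂ q₁ r₂ _ pq pr qr =
    no-monoTriangle-₂₂₁ p₂ r₂ q₁ pr pq (MonoEdge-sym qr)
  no-monoTriangle-even {σ = false} {true}  {true}  p₁ q₂ r₂ _ pq pr qr =
    no-monoTriangle-₂₂₁ q₂ r₂ p₁ qr (MonoEdge-sym pq) (MonoEdge-sym pr)
  no-monoTriangle-even {σ = true}  {true}  {true}  _ _ _ ()
  no-monoTriangle-even {σ = true}  {false} {false} _ _ _ ()
  no-monoTriangle-even {σ = false} {true}  {false} _ _ _ ()
  no-monoTriangle-even {σ = false} {false} {true}  _ _ _ ()

  -- Unless all four vertices lie in V₂, dropping a vertex whose side equals the parity of the
  -- whole K₄ leaves a triangle with an even number of vertices in V₂.
  no-monoK4 : ∀ {k a b c d} → MonoK4 k a b c d → ⊥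
  no-monoK4 {a = a} {b} {c} {d} K@(ab , ac , ad , bc , bd , cd) = bySide _ _ _ _ refl refl refl refl
    where
    bySide : ∀ σa σb σc σd → side a ≡ σa → side b ≡ σb → side c ≡ σc → side d ≡ σd → ⊥
    bySide true  true  true  true  a′ b′ c′ d′ = no-monoK4-inV₂ a′ b′ c′ d′ K
    bySide true  true  true  false a′ b′ c′ d′ = no-monoTriangle-even b′ c′ d′ refl bc bd cd
    bySide true  true  false true  a′ b′ c′ d′ = no-monoTriangle-even b′ c′ d′ refl bc bd cd
    bySide true  true  false false a′ b′ c′ d′ = no-monoTriangle-even a′ b′ d′ refl ab ad bd
    bySide true  false true  true  a′ b′ c′ d′ = no-monoTriangle-even b′ c′ d′ refl bc bd cd
    bySide true  false true  false a′ b′ c′ d′ = no-monoTriangle-even a′ c′ d′ refl ac ad cd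
    bySide true  false false true  a′ b′ c′ d′ = no-monoTriangle-even a′ c′ d′ refl ac ad cd
    bySide true  false false false a′ b′ c′ d′ = no-monoTriangle-even b′ c′ d′ refl bc bd cd
    bySide false true  true  true  a′ b′ c′ d′ = no-monoTriangle-even a′ c′ d′ refl ac ad cd
    bySide false true  true  false a′ b′ c′ d′ = no-monoTriangle-even b′ c′ d′ refl bc bd cd
    bySide false true  false true  a′ b′ c′ d′ = no-monoTriangle-even b′ c′ d′ refl bc bd cd
    bySide false true  false false a′ b′ c′ d′ = no-monoTriangle-even a′ c′ d′ refl ac ad cd
    bySide false false true  true  a′ b′ c′ d′ = no-monoTriangle-even b′ c′ d′ refl bc bd cd
    bySide false false true  false a′ b′ c′ d′ = no-monoTriangle-even a′ b′ d′ refl ab ad bd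
    bySide false false false true  a′ b′ c′ d′ = no-monoTriangle-even a′ b′ c′ refl ab ac bc
    bySide false false false false a′ b′ c′ d′ = no-monoTriangle-even b′ c′ d′ refl bc bd cd

  isK4⇒monoK4 : ∀ {a b d e} → IsK4 G a b d e →
    colour a b ≡ colour a d × colour a b ≡ colour a e × colour a b ≡ colour b d ×
    colour a b ≡ colour b e × colour a b ≡ colour d e →
    MonoK4 (colour a b) a b d e
  isK4⇒monoK4 (ab , ad , ae , bd , be , de) (≡ad , ≡ae , ≡bd , ≡be , ≡de) =
    (ab , refl) , (ad , sym ≡ad) , (ae , sym ≡ae) , (bd , sym ≡bd) , (be , sym ≡be) , (de , sym ≡de)

lemma3p8 : (n : ℕ) (G : Graph n) (side : Fin n → Bool) →
    NotArrowsK3On G (In₁ side) →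
    NotVertexArrowsK4On G (In₂ side) →
    ((H : SubgraphOn G (In₂ side)) → ¬ DenseSmall H) →
    NotArrowsK4K4 G
lemma3p8 n G side edge₁ vertex₂ sparse =
  (colour , colour-sym) , λ a b d e K₄ monochromatic → no-monoK4 (isK4⇒monoK4 K₄ monochromatic)
  where open Construction G side edge₁ vertex₂ sparse
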